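{- Let $d\in\mathbb{Q}$ with $\sqrt{d}\notin\mathbb{Q}$, and let $f\colon\mathbb{Q}(\sqrt{d})\to\mathbb{Q}(\sqrt{d})$ be an SD map. Then exactly one of the following holds: (1) $f(\sqrt{d})=\sqrt{d}$, and for every $z\in\mathbb{Q}(\sqrt{d})$, $f(z)\in\{z,-z\}$; (2) $f(\sqrt{d})=-\sqrt{d}$, and for every $z\in\mathbb{Q}(\sqrt{d})$, $f(z)\in\{\overline{z},-\overline{z}\}$.
   Context: An SD map on a field $\mathbb{F}$ is a function $f\colon \mathbb{F}\to\mathbb{F}$ such that for all $x \neq y$ in $\mathbb{F}$ one has $f(x)\neq f(y)$ and $f\left(\frac{x+y}{x-y}\right) = \frac{f(x)+f(y)}{f(x)-f(y)}$. Conjugation on $\mathbb{Q}(\sqrt{d})$ is defined by $\overline{a+b\sqrt{d}}=a-b\sqrt{d}$ for $a,b\in\mathbb{Q}$. -}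

module Defs where

open import Data.Rational using (ℚ; 0ℚ; 1ℚ; _+_; _-_; _*_; -_; 1/_; ≢-nonZero)
open import Data.Rational.Properties using (_≟_)
open import Data.Product using (_×_)
open import Data.Sum using (_⊎_)
open import Relation.Nullary using (yes; no; ¬_)
open import Relation.Binary.PropositionalEquality using (_≡_; _≢_)

-- Elements a + b√d of ℚ(√d), represented by the pair (a , b).
-- When √d ∉ ℚ this representation is unique, so _≡_ is equality in the field.
record QS (d : ℚ) : Set where
  constructor _+_√
  field
    re : ℚ
    im : ℚ
open QS public

module _ {d : ℚ} where
  _⊕_ : QS d → QS d → QS d
  (a + b √) ⊕ (c + e √) = (a + c) + (b + e) √

  ⊖_ : QS d → QS d
  ⊖ (a + b √) = (- a) + (- b) √

  _⊝_ : QS d → QS d → QS d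
  x ⊝ y = x ⊕ (⊖ y)

  _⊗_ : QS d → QS d → QS d
  (a + b √) ⊗ (c + e √) = (a * c + d * (b * e)) + (a * e + b * c) √

  -- total reciprocal on ℚ (0 ↦ 0); only ever applied to nonzero values below
  inv : ℚ → ℚ
  inv p with p ≟ 0ℚ
  ... | yes _ = 0ℚ
  ... | no p≢0 = 1/_ p {{≢-nonZero p≢0}}

  -- multiplicative inverse in ℚ(√d): (a + b√d)⁻¹ = (a - b√d)/(a² - d b²)
  -- (total; 0 ↦ 0, but only used for nonzero arguments)
  recip : QS d → QS d
  recip (a + b √) = (a * n) + (- (b * n)) √
    where n = inv (a * a - d * (b * b))

  _⊘_ : QS d → QS d → QS d
  x ⊘ y = x ⊗ recip y

  conj : QS d → QS d
  conj (a + b √) = a + (- b) √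

  √d : QS d
  √d = 0ℚ + 1ℚ √

IsSD : (d : ℚ) → (QS d → QS d) → Set
IsSD d f = ∀ (x y : QS d) → x ≢ y →
  (f x ≢ f y) × (f ((x ⊕ y) ⊘ (x ⊝ y)) ≡ (f x ⊕ f y) ⊘ (f x ⊝ f y))

Case1 : (d : ℚ) → (QS d → QS d) → Set
Case1 d f = (f √d ≡ √d) × (∀ z → (f z ≡ z) ⊎ (f z ≡ ⊖ z))

Case2 : (d : ℚ) → (QS d → QS d) → Set
Case2 d f = (f √d ≡ ⊖ √d) × (∀ z → (f z ≡ conj z) ⊎ (f z ≡ ⊖ conj z))

{-# OPTIONS --safe #-}
module Submission where

-- An SD map f on a field of characteristic 0 is injective, fixes 0 and 1, is odd and
-- multiplicative, and satisfies f (x + y) (f x - f y) = (f x + f y) f (x - y).  Comparing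
-- these relations at a few integers forces f 2 = 2, and then by induction f fixes every
-- integer, hence every rational.  So f (√d) squares to d, i.e. f (√d) = ±√d.  For
-- z = a + b√d both a and b√d have rational squares, and the relation above then gives
-- f z ² = (a + b f (√d))², hence f z = ±(a + b f (√d)).

open import Algebra.Bundles using (CommutativeRing)
open import Algebra.Core using (Op₁; Op₂)
import Algebra.Definitions
import Algebra.Properties.Group as GroupProperties
import Algebra.Solver.Ring as RingSolver
open import Algebra.Solver.Ring.AlmostCommutativeRing
  using (_-Raw-AlmostCommutative⟶_; fromCommutativeRing)
open import Algebra.Structures using (IsCommutativeRing)
open import Data.Empty using (⊥-elim)
open import Data.Integer.Base as ℤ using (+_; -[1+_])
import Data.Integer.Properties as ℤ
open import Data.Integer.Tactic.RingSolver using (solve-∀)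
open import Data.List.Base using (_∷_; [])
open import Data.Maybe.Base using (map)
open import Data.Nat.Base using (ℕ; suc)
open import Data.Product.Base using (_×_; _,_; proj₁; proj₂)
open import Data.Rational.Base as ℚ using (ℚ; 0ℚ; 1ℚ; ↥_; ↧_; mkℚ)
open import Data.Rational.Literals using (fromℤ)
import Data.Rational.Properties as ℚ
import Data.Rational.Unnormalised.Base as ℚᵘ
import Data.Rational.Unnormalised.Properties as ℚᵘ
open import Data.Sum.Base as Sum using (_⊎_; inj₁; inj₂)
open import Function.Base using (_∘_; id)
open import Level using (0ℓ)
open import Relation.Binary.Definitions using (DecidableEquality)
open import Relation.Binary.PropositionalEquality
open import Relation.Nullary.Decidable using (yes; no; dec⇒maybe; map′; _×-dec_)
open import Relation.Nullary.Negation using (¬_)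
import Tactic.RingSolver as Tactic
import Tactic.RingSolver.Core.AlmostCommutativeRing as Tactic

open import Defs

open GroupProperties ℚ.+-0-group using () renaming (x∙y⁻¹≈ε⇒x≈y to p-q≡0⇒p≡q)

fromℤ-suc : ∀ n → fromℤ (+ suc n) ≡ fromℤ (+ n) ℚ.+ 1ℚ
fromℤ-suc n = ℚ.toℚᵘ-injective
  (ℚᵘ.≃-trans (ℚᵘ.*≡* (identity (+ n))) (ℚᵘ.≃-sym (ℚ.toℚᵘ-homo-+ (fromℤ (+ n)) 1ℚ)))
  where
  identity : ∀ m → (+ 1 ℤ.+ m) ℤ.* (+ 1 ℤ.* + 1) ≡ (m ℤ.* + 1 ℤ.+ + 1 ℤ.* + 1) ℤ.* + 1
  identity = solve-∀

*-↧≡↥ : ∀ p → p ℚ.* fromℤ (↧ p) ≡ fromℤ (↥ p)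
*-↧≡↥ p@(mkℚ _ _ _) = ℚ.toℚᵘ-injective
  (ℚᵘ.≃-trans (ℚ.toℚᵘ-homo-* p (fromℤ (↧ p))) (ℚᵘ.*≡* (identity (↥ p) (↧ p))))
  where
  identity : ∀ m n → (m ℤ.* n) ℤ.* + 1 ≡ m ℤ.* (n ℤ.* + 1)
  identity = solve-∀

-- A field of characteristic 0 with its embedding ι of ℚ.  Its zero and one are ι 0ℚ and ι 1ℚ
-- on the nose, so that the solver's constants con 0ℚ and con 1ℚ denote 0# and 1#.
module FieldOverℚ
  {F : Set} (ι : ℚ → F) {_+′_ _*′_ : Op₂ F} { -′_ : Op₁ F}
  (isCommutativeRing : IsCommutativeRing _≡_ _+′_ _*′_ -′_ (ι 0ℚ) (ι 1ℚ))
  (ι-+ : ∀ p q → ι (p ℚ.+ q) ≡ ι p +′ ι q)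
  (ι-* : ∀ p q → ι (p ℚ.* q) ≡ ι p *′ ι q)
  (_≟_ : DecidableEquality F)
  (_⁻¹ : Op₁ F)
  (*-inverseʳ : ∀ {x} → x ≢ ι 0ℚ → x *′ (x ⁻¹) ≡ ι 1ℚ)
  (0≢1 : ι 0ℚ ≢ ι 1ℚ)
  where

  ring : CommutativeRing 0ℓ 0ℓ
  ring = record { isCommutativeRing = isCommutativeRing }

  open CommutativeRing ring
    using (_+_; _*_; -_; _-_; 0#; 1#; +-group; *-assoc; *-identityˡ; *-identityʳ; zeroˡ; zeroʳ)
  open GroupProperties +-group
    using (ε⁻¹≈ε; inverseˡ-unique; inverseʳ-unique)
    renaming (x∙y⁻¹≈ε⇒x≈y to x-y≡0⇒x≡y; x≈y⇒x∙y⁻¹≈ε to x≡y⇒x-y≡0)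
  open ≡-Reasoning

  ι-‿ : ∀ p → ι (ℚ.- p) ≡ - ι p
  ι-‿ p = inverseˡ-unique (ι (ℚ.- p)) (ι p) (begin
    ι (ℚ.- p) + ι p    ≡⟨ ι-+ (ℚ.- p) p ⟨
    ι (ℚ.- p ℚ.+ p)    ≡⟨ cong ι (ℚ.+-inverseˡ p) ⟩
    0#                 ∎)

  private
    ι-morphism : ℚ.+-*-rawRing -Raw-AlmostCommutative⟶ fromCommutativeRing ring
    ι-morphism = record
      { ⟦_⟧ = ι ; +-homo = ι-+ ; *-homo = ι-* ; -‿homo = ι-‿ ; 0-homo = refl ; 1-homo = refl }

  open RingSolver ℚ.+-*-rawRing (fromCommutativeRing ring) ι-morphism
    (λ p q → map (cong ι) (dec⇒maybe (p ℚ.≟ q)))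
    using (Polynomial; solve; _:=_; con; _:+_; _:*_; _:-_; :-_)

  private
    #_ : ∀ {m} → ℕ → Polynomial m
    # n = con (fromℤ (+ n))

  fromℕ : ℕ → F
  fromℕ n = ι (fromℤ (+ n))

  _/_ : Op₂ F
  x / y = x * y ⁻¹

  x≢y⇒x-y≢0 : ∀ {x y} → x ≢ y → x - y ≢ 0#
  x≢y⇒x-y≢0 x≢y = x≢y ∘ x-y≡0⇒x≡y _ _

  x*y*y⁻¹≡x : ∀ x {y} → y ≢ 0# → x * y * y ⁻¹ ≡ x
  x*y*y⁻¹≡x x {y} y≢0 = begin
    x * y * y ⁻¹    ≡⟨ *-assoc x y (y ⁻¹) ⟩
    x * (y * y ⁻¹)  ≡⟨ cong (x *_) (*-inverseʳ y≢0) ⟩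
    x * 1#          ≡⟨ *-identityʳ x ⟩
    x               ∎

  x/y*y≡x : ∀ x {y} → y ≢ 0# → x / y * y ≡ x
  x/y*y≡x x {y} y≢0 = begin
    x * y ⁻¹ * y    ≡⟨ solve 3 (λ x y z → x :* z :* y := x :* y :* z) refl x y (y ⁻¹) ⟩
    x * y * y ⁻¹    ≡⟨ x*y*y⁻¹≡x x y≢0 ⟩
    x               ∎

  *-cancelʳ : ∀ {x y z} → z ≢ 0# → x * z ≡ y * z → x ≡ y
  *-cancelʳ {x} {y} {z} z≢0 xz≡yz = begin
    x               ≡⟨ x*y*y⁻¹≡x x z≢0 ⟨
    x * z * z ⁻¹    ≡⟨ cong (_* z ⁻¹) xz≡yz ⟩
    y * z * z ⁻¹    ≡⟨ x*y*y⁻¹≡x y z≢0 ⟩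
    y               ∎

  x*y≡0⇒x≡0⊎y≡0 : ∀ {x y} → x * y ≡ 0# → x ≡ 0# ⊎ y ≡ 0#
  x*y≡0⇒x≡0⊎y≡0 {x} {y} xy≡0 with y ≟ 0#
  ... | yes y≡0 = inj₂ y≡0
  ... | no  y≢0 = inj₁ (*-cancelʳ y≢0 (trans xy≡0 (sym (zeroˡ y))))

  x*x≡y*y⇒x≡y⊎x≡-y : ∀ {x y} → x * x ≡ y * y → x ≡ y ⊎ x ≡ - y
  x*x≡y*y⇒x≡y⊎x≡-y {x} {y} x²≡y² =
    Sum.map (x-y≡0⇒x≡y x y) (inverseˡ-unique x y) (x*y≡0⇒x≡0⊎y≡0 (begin
      (x - y) * (x + y)  ≡⟨ solve 2 (λ x y → (x :- y) :* (x :+ y) := x :* x :- y :* y) refl x y ⟩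
      x * x - y * y      ≡⟨ x≡y⇒x-y≡0 x²≡y² ⟩
      0#                 ∎))

  linear-combination : ∀ {p k₁ l₁ r₁ k₂ l₂ r₂} →
    p ≡ k₁ * (l₁ - r₁) + k₂ * (l₂ - r₂) → l₁ ≡ r₁ → l₂ ≡ r₂ → p ≡ 0#
  linear-combination {k₁ = k₁} {l₁} {k₂ = k₂} {l₂} p≡ refl refl = trans p≡
    (solve 4 (λ k₁ l₁ k₂ l₂ → k₁ :* (l₁ :- l₁) :+ k₂ :* (l₂ :- l₂) := con 0ℚ) refl k₁ l₁ k₂ l₂)

  ι≢0 : ∀ {r} → r ≢ 0ℚ → ι r ≢ 0#
  ι≢0 {r} r≢0 ιr≡0 = 0≢1 (begin
    0#                 ≡⟨ zeroˡ (ι (ℚ.1/ r)) ⟨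
    0# * ι (ℚ.1/ r)    ≡⟨ cong (_* ι (ℚ.1/ r)) ιr≡0 ⟨
    ι r * ι (ℚ.1/ r)   ≡⟨ ι-* r (ℚ.1/ r) ⟨
    ι (r ℚ.* ℚ.1/ r)   ≡⟨ cong ι (ℚ.*-inverseʳ r) ⟩
    1#                 ∎)
    where instance _ = ℚ.≢-nonZero r≢0

  ι-difference : ∀ p q → ι (p ℚ.- q) ≡ ι p - ι q
  ι-difference p q = trans (ι-+ p (ℚ.- q)) (cong (λ z → ι p + z) (ι-‿ q))

  ι-injective : ∀ {p q} → ι p ≡ ι q → p ≡ q
  ι-injective {p} {q} ιp≡ιq with p ℚ.- q ℚ.≟ 0ℚ
  ... | yes p-q≡0 = p-q≡0⇒p≡q p q p-q≡0
  ... | no  p-q≢0 = ⊥-elim (ι≢0 p-q≢0 (begin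
    ι (p ℚ.- q)        ≡⟨ ι-difference p q ⟩
    ι p - ι q          ≡⟨ x≡y⇒x-y≡0 ιp≡ιq ⟩
    0#                 ∎))

  fromℕ-injective : ∀ {m n} → fromℕ m ≡ fromℕ n → m ≡ n
  fromℕ-injective = ℤ.+-injective ∘ cong ↥_ ∘ ι-injective

  fromℕ-≢ : ∀ {m n} → m ≢ n → fromℕ m ≢ fromℕ n
  fromℕ-≢ m≢n = m≢n ∘ fromℕ-injective

  fromℕ-suc : ∀ n → fromℕ (suc n) ≡ fromℕ n + 1#
  fromℕ-suc n = trans (cong ι (fromℤ-suc n)) (ι-+ (fromℤ (+ n)) 1ℚ)

  fromℕ-pred : ∀ n → fromℕ (suc n) - 1# ≡ fromℕ n
  fromℕ-pred n = begin
    fromℕ (suc n) - 1#   ≡⟨ cong (_- 1#) (fromℕ-suc n) ⟩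
    fromℕ n + 1# - 1#    ≡⟨ solve 1 (λ x → x :+ con 1ℚ :- con 1ℚ := x) refl (fromℕ n) ⟩
    fromℕ n              ∎

  fromℕ-suc≢0 : ∀ n → fromℕ (suc n) ≢ 0#
  fromℕ-suc≢0 n = ι≢0 (λ ())

  fromℕ≢-1 : ∀ n → fromℕ n ≢ - 1#
  fromℕ≢-1 n fromℕn≡-1 = fromℕ-suc≢0 n (begin
    fromℕ (suc n)   ≡⟨ fromℕ-suc n ⟩
    fromℕ n + 1#    ≡⟨ cong (_+ 1#) fromℕn≡-1 ⟩
    - 1# + 1#       ≡⟨ solve 0 (:- con 1ℚ :+ con 1ℚ := con 0ℚ) refl ⟩
    0#              ∎)

  x≢0⇒x≢-x : ∀ {x} → x ≢ 0# → x ≢ - x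
  x≢0⇒x≢-x {x} x≢0 x≡-x = Sum.[ fromℕ-suc≢0 1 , x≢0 ]′ (x*y≡0⇒x≡0⊎y≡0 2x≡0)
    where
    2x≡0 : fromℕ 2 * x ≡ 0#
    2x≡0 = begin
      fromℕ 2 * x  ≡⟨ solve 1 (λ x → # 2 :* x := x :- :- x) refl x ⟩
      x - - x      ≡⟨ x≡y⇒x-y≡0 x≡-x ⟩
      0#           ∎

  IsSDMap : (F → F) → Set
  IsSDMap f = ∀ x y → x ≢ y →
    f x ≢ f y × f ((x + y) / (x - y)) ≡ (f x + f y) / (f x - f y)

  module SDMap {f : F → F} (isSDMap : IsSDMap f) where

    Fixed : F → Set
    Fixed x = f x ≡ x

    injective : ∀ {x y} → x ≢ y → f x ≢ f y
    injective {x} {y} x≢y = proj₁ (isSDMap x y x≢y)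

    sd-equation : ∀ {x y q} → x ≢ y → q * (x - y) ≡ x + y → f q * (f x - f y) ≡ f x + f y
    sd-equation {x} {y} {q} x≢y q[x-y]≡x+y = begin
      f q * (f x - f y)                        ≡⟨ cong (λ z → f z * (f x - f y)) q≡[x+y]/[x-y] ⟩
      f ((x + y) / (x - y)) * (f x - f y)      ≡⟨ cong (_* (f x - f y)) (proj₂ (isSDMap x y x≢y)) ⟩
      (f x + f y) / (f x - f y) * (f x - f y)  ≡⟨ x/y*y≡x (f x + f y) (x≢y⇒x-y≢0 (injective x≢y)) ⟩
      f x + f y                                ∎
      where
      q≡[x+y]/[x-y] : q ≡ (x + y) / (x - y)
      q≡[x+y]/[x-y] = *-cancelʳ (x≢y⇒x-y≢0 x≢y)
        (trans q[x-y]≡x+y (sym (x/y*y≡x (x + y) (x≢y⇒x-y≢0 x≢y))))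

    sd-equation-at-1 : ∀ {x} → x ≢ 0# → f 1# * (f x - f 0#) ≡ f x + f 0#
    sd-equation-at-1 {x} x≢0 = sd-equation x≢0
      (solve 1 (λ x → con 1ℚ :* (x :- con 0ℚ) := x :+ con 0ℚ) refl x)

    f-1 : Fixed 1#
    f-1 = Sum.[ x-y≡0⇒x≡y (f 1#) 1# , ⊥-elim ∘ injective 1≢2 ∘ x-y≡0⇒x≡y (f 1#) (f (fromℕ 2)) ]′
      (x*y≡0⇒x≡0⊎y≡0 product≡0)
      where
      1≢2 : 1# ≢ fromℕ 2
      1≢2 = fromℕ-≢ (λ ())
      product≡0 : (f 1# - 1#) * (f 1# - f (fromℕ 2)) ≡ 0#
      product≡0 = linear-combination
        (solve 3 (λ c a b → (c :- con 1ℚ) :* (c :- b)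
                         := con 1ℚ :* (c :* (c :- a) :- (c :+ a)) :+ (:- con 1ℚ) :* (c :* (b :- a) :- (b :+ a)))
                 refl (f 1#) (f 0#) (f (fromℕ 2)))
        (sd-equation-at-1 (0≢1 ∘ sym)) (sd-equation-at-1 (fromℕ-suc≢0 1))

    f-0 : Fixed 0#
    f-0 = Sum.[ id , ⊥-elim ∘ fromℕ-suc≢0 1 ]′ (x*y≡0⇒x≡0⊎y≡0 product≡0)
      where
      product≡0 : f 0# * fromℕ 2 ≡ 0#
      product≡0 = linear-combination
        (solve 2 (λ c a → a :* # 2 := (:- con 1ℚ) :* (c :* (c :- a) :- (c :+ a)) :+ (c :- a) :* (c :- con 1ℚ))
               refl (f 1#) (f 0#))
        (sd-equation-at-1 (0≢1 ∘ sym)) f-1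

    f-odd : ∀ x → f (- x) ≡ - f x
    f-odd x with x ≟ 0#
    ... | yes refl = begin
      f (- 0#)  ≡⟨ cong f ε⁻¹≈ε ⟩
      f 0#      ≡⟨ f-0 ⟩
      0#        ≡⟨ ε⁻¹≈ε ⟨
      - 0#      ≡⟨ cong -_ f-0 ⟨
      - f 0#    ∎
    ... | no x≢0 = inverseʳ-unique (f x) (f (- x)) (begin
      f x + f (- x)             ≡⟨ sd-equation (x≢0⇒x≢-x x≢0) (solve 1 (λ x → con 0ℚ :* (x :- :- x) := x :+ :- x) refl x) ⟨
      f 0# * (f x - f (- x))    ≡⟨ cong (_* (f x - f (- x))) f-0 ⟩
      0# * (f x - f (- x))      ≡⟨ zeroˡ (f x - f (- x)) ⟩
      0#                        ∎)

    -- m = (x + 1) / (x - 1) is the SD quotient both of (x , 1) and of (x y , y).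
    f-*-generic : ∀ {x y} → y ≢ 0# → x ≢ 1# → f (x * y) ≡ f x * f y
    f-*-generic {x} {y} y≢0 x≢1 =
      Sum.[ x-y≡0⇒x≡y (f (x * y)) (f x * f y) , ⊥-elim ∘ fm≢1 ∘ x-y≡0⇒x≡y (f m) 1# ]′
        (x*y≡0⇒x≡0⊎y≡0 product≡0)
      where
      m = (x + 1#) / (x - 1#)
      m[x-1]≡x+1 : m * (x - 1#) ≡ x + 1#
      m[x-1]≡x+1 = x/y*y≡x (x + 1#) (x≢y⇒x-y≢0 x≢1)
      xy≢y : x * y ≢ y
      xy≢y xy≡y = x≢1 (*-cancelʳ y≢0 (trans xy≡y (sym (*-identityˡ y))))
      m[xy-y]≡xy+y : m * (x * y - y) ≡ x * y + y
      m[xy-y]≡xy+y = begin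
        m * (x * y - y)   ≡⟨ solve 3 (λ m x y → m :* (x :* y :- y) := m :* (x :- con 1ℚ) :* y) refl m x y ⟩
        m * (x - 1#) * y  ≡⟨ cong (_* y) m[x-1]≡x+1 ⟩
        (x + 1#) * y      ≡⟨ solve 2 (λ x y → (x :+ con 1ℚ) :* y := x :* y :+ y) refl x y ⟩
        x * y + y         ∎
      equation-xy : f m * (f (x * y) - f y) ≡ f (x * y) + f y
      equation-xy = sd-equation xy≢y m[xy-y]≡xy+y
      equation-x : f m * (f x - 1#) ≡ f x + 1#
      equation-x = subst (λ c → f m * (f x - c) ≡ f x + c) f-1 (sd-equation x≢1 m[x-1]≡x+1)
      fm≢1 : f m ≢ 1#
      fm≢1 fm≡1 = fromℕ-suc≢0 1 (linear-combination
        (solve 2 (λ M X → # 2 := (:- con 1ℚ) :* (M :* (X :- con 1ℚ) :- (X :+ con 1ℚ)) :+ (X :- con 1ℚ) :* (M :- con 1ℚ))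
               refl (f m) (f x))
        equation-x fm≡1)
      product≡0 : (f (x * y) - f x * f y) * (f m - 1#) ≡ 0#
      product≡0 = linear-combination
        (solve 4 (λ M P X Y → (P :- X :* Y) :* (M :- con 1ℚ)
                           := con 1ℚ :* (M :* (P :- Y) :- (P :+ Y)) :+ (:- Y) :* (M :* (X :- con 1ℚ) :- (X :+ con 1ℚ)))
               refl (f m) (f (x * y)) (f x) (f y))
        equation-xy equation-x

    f-* : ∀ x y → f (x * y) ≡ f x * f y
    f-* x y with y ≟ 0# | x ≟ 1#
    ... | yes refl | _ = begin
      f (x * 0#)   ≡⟨ cong f (zeroʳ x) ⟩
      f 0#         ≡⟨ f-0 ⟩
      0#           ≡⟨ zeroʳ (f x) ⟨
      f x * 0#     ≡⟨ cong (f x *_) f-0 ⟨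
      f x * f 0#   ∎
    ... | no _ | yes refl = begin
      f (1# * y)   ≡⟨ cong f (*-identityˡ y) ⟩
      f y          ≡⟨ *-identityˡ (f y) ⟨
      1# * f y     ≡⟨ cong (_* f y) f-1 ⟨
      f 1# * f y   ∎
    ... | no y≢0 | no x≢1 = f-*-generic y≢0 x≢1

    f-+-relation : ∀ {x y} → x ≢ y → f (x + y) * (f x - f y) ≡ (f x + f y) * f (x - y)
    f-+-relation {x} {y} x≢y = begin
      f (x + y) * (f x - f y)        ≡⟨ cong (λ z → f z * (f x - f y)) q[x-y]≡x+y ⟨
      f (q * (x - y)) * (f x - f y)  ≡⟨ cong (_* (f x - f y)) (f-* q (x - y)) ⟩
      f q * f (x - y) * (f x - f y)  ≡⟨ solve 3 (λ a b c → a :* b :* c := a :* c :* b) refl (f q) (f (x - y)) (f x - f y) ⟩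
      f q * (f x - f y) * f (x - y)  ≡⟨ cong (_* f (x - y)) (sd-equation x≢y q[x-y]≡x+y) ⟩
      (f x + f y) * f (x - y)        ∎
      where
      q = (x + y) / (x - y)
      q[x-y]≡x+y : q * (x - y) ≡ x + y
      q[x-y]≡x+y = x/y*y≡x (x + y) (x≢y⇒x-y≢0 x≢y)

    -- The relations at (2 , 1), (3 , 2) and (4 , 1) involve a = f 2, b = f 3 and f 5;
    -- eliminating f 5 and then b leaves a polynomial equation in a.
    f-2-root : let a = f (fromℕ 2) in a * ((a * a + 1#) * ((a + 1#) * (a - fromℕ 2))) ≡ 0#
    f-2-root = linear-combination
      (solve 2 (λ a b → a :* ((a :* a :+ con 1ℚ) :* ((a :+ con 1ℚ) :* (a :- # 2)))
                     := con ℚ.½ :* ((a :* a :+ con 1ℚ) :* (b :* (a :- con 1ℚ) :+ a :+ con 1ℚ :- a :* (a :- con 1ℚ))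
                                    :- (a :- con 1ℚ) :* (a :* a :- con 1ℚ))
                          :* (b :* (a :- con 1ℚ) :- (a :+ con 1ℚ) :* con 1ℚ)
                        :+ (:- con ℚ.½ :* ((a :- con 1ℚ) :* (a :- con 1ℚ)))
                          :* ((a :* a :+ con 1ℚ) :* b :* (b :- a) :- (b :+ a) :* (a :* a :- con 1ℚ)))
             refl a b)
      relation-2-1 eliminate-f5
      where
      a = f (fromℕ 2)
      b = f (fromℕ 3)
      c = f (fromℕ 5)
      relation : ∀ {x y s t} → x ≢ y → x + y ≡ s → x - y ≡ t → f s * (f x - f y) ≡ (f x + f y) * f t
      relation x≢y refl refl = f-+-relation x≢y
      relation-2-1 : b * (a - 1#) ≡ (a + 1#) * 1#
      relation-2-1 = subst (λ u → b * (a - u) ≡ (a + u) * u) f-1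
        (relation (fromℕ-≢ (λ ())) (solve 0 (# 2 :+ con 1ℚ := # 3) refl) (solve 0 (# 2 :- con 1ℚ := con 1ℚ) refl))
      relation-3-2 : c * (b - a) ≡ (b + a) * 1#
      relation-3-2 = subst (λ u → c * (b - a) ≡ (b + a) * u) f-1
        (relation (fromℕ-≢ (λ ())) (solve 0 (# 3 :+ # 2 := # 5) refl) (solve 0 (# 3 :- # 2 := con 1ℚ) refl))
      f-4 : f (fromℕ 4) ≡ a * a
      f-4 = trans (cong f (solve 0 (# 4 := # 2 :* # 2) refl)) (f-* (fromℕ 2) (fromℕ 2))
      relation-4-1 : c * (a * a - 1#) ≡ (a * a + 1#) * b
      relation-4-1 = subst₂ (λ u v → c * (u - v) ≡ (u + v) * b) f-4 f-1
        (relation (fromℕ-≢ (λ ())) (solve 0 (# 4 :+ con 1ℚ := # 5) refl) (solve 0 (# 4 :- con 1ℚ := # 3) refl))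
      eliminate-f5 : (a * a + 1#) * b * (b - a) ≡ (b + a) * (a * a - 1#)
      eliminate-f5 = x-y≡0⇒x≡y _ _ (linear-combination
        (solve 3 (λ a b c → (a :* a :+ con 1ℚ) :* b :* (b :- a) :- (b :+ a) :* (a :* a :- con 1ℚ)
                         := (a :* a :- con 1ℚ) :* (c :* (b :- a) :- (b :+ a) :* con 1ℚ)
                            :+ (:- (b :- a)) :* (c :* (a :* a :- con 1ℚ) :- (a :* a :+ con 1ℚ) :* b))
               refl a b c)
        relation-3-2 relation-4-1)

    f-2 : Fixed (fromℕ 2)
    f-2 = root (Sum.map₂ (Sum.map₂ x*y≡0⇒x≡0⊎y≡0 ∘ x*y≡0⇒x≡0⊎y≡0) (x*y≡0⇒x≡0⊎y≡0 f-2-root))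
      where
      a = f (fromℕ 2)
      f-[-1] : f (- 1#) ≡ - 1#
      f-[-1] = trans (f-odd 1#) (cong -_ f-1)
      a≢0 : a ≢ 0#
      a≢0 a≡0 = injective (fromℕ-suc≢0 1) (trans a≡0 (sym f-0))
      a≢-1 : a ≢ - 1#
      a≢-1 a≡-1 = injective (fromℕ≢-1 2) (trans a≡-1 (sym f-[-1]))
      a*a≢-1 : a * a ≢ - 1#
      a*a≢-1 a*a≡-1 = injective (fromℕ≢-1 4) (begin
        f (fromℕ 4)              ≡⟨ cong f (solve 0 (# 4 := # 2 :* # 2) refl) ⟩
        f (fromℕ 2 * fromℕ 2)    ≡⟨ f-* (fromℕ 2) (fromℕ 2) ⟩
        a * a                    ≡⟨ a*a≡-1 ⟩
        - 1#                     ≡⟨ f-[-1] ⟨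
        f (- 1#)                 ∎)
      root : a ≡ 0# ⊎ a * a + 1# ≡ 0# ⊎ a + 1# ≡ 0# ⊎ a - fromℕ 2 ≡ 0# → Fixed (fromℕ 2)
      root (inj₁ a≡0)                   = ⊥-elim (a≢0 a≡0)
      root (inj₂ (inj₁ a*a+1≡0))        = ⊥-elim (a*a≢-1 (inverseˡ-unique (a * a) 1# a*a+1≡0))
      root (inj₂ (inj₂ (inj₁ a+1≡0)))   = ⊥-elim (a≢-1 (inverseˡ-unique a 1# a+1≡0))
      root (inj₂ (inj₂ (inj₂ a-2≡0)))   = x-y≡0⇒x≡y a (fromℕ 2) a-2≡0

    f-+1 : ∀ {x} → x ≢ 1# → Fixed x → Fixed (x - 1#) → Fixed (x + 1#)
    f-+1 {x} x≢1 fx≡x fx-1≡x-1 = *-cancelʳ (x≢y⇒x-y≢0 x≢1) (begin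
      f (x + 1#) * (x - 1#)      ≡⟨ cong₂ (λ u v → f (x + 1#) * (u - v)) fx≡x f-1 ⟨
      f (x + 1#) * (f x - f 1#)  ≡⟨ f-+-relation x≢1 ⟩
      (f x + f 1#) * f (x - 1#)  ≡⟨ cong₂ (λ u v → (u + v) * f (x - 1#)) fx≡x f-1 ⟩
      (x + 1#) * f (x - 1#)      ≡⟨ cong ((x + 1#) *_) fx-1≡x-1 ⟩
      (x + 1#) * (x - 1#)        ∎)

    f-fromℕ : ∀ n → Fixed (fromℕ n)
    f-fromℕ 0 = f-0
    f-fromℕ 1 = f-1
    f-fromℕ 2 = f-2
    f-fromℕ (suc (suc (suc n))) = subst Fixed (sym (fromℕ-suc (suc (suc n))))
      (f-+1 (fromℕ-≢ (λ ())) (f-fromℕ (suc (suc n)))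
        (subst Fixed (sym (fromℕ-pred (suc n))) (f-fromℕ (suc n))))

    f-fromℤ : ∀ z → Fixed (ι (fromℤ z))
    f-fromℤ (+ n)    = f-fromℕ n
    f-fromℤ -[1+ n ] = begin
      f (ι (ℚ.- fromℤ (+ suc n)))  ≡⟨ cong f (ι-‿ (fromℤ (+ suc n))) ⟩
      f (- fromℕ (suc n))          ≡⟨ f-odd (fromℕ (suc n)) ⟩
      - f (fromℕ (suc n))          ≡⟨ cong -_ (f-fromℕ (suc n)) ⟩
      - fromℕ (suc n)              ≡⟨ ι-‿ (fromℤ (+ suc n)) ⟨
      ι (ℚ.- fromℤ (+ suc n))      ∎

    f-ι : ∀ r → Fixed (ι r)
    f-ι r@(mkℚ n d-1 _) = *-cancelʳ (fromℕ-suc≢0 d-1) (begin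
      f (ι r) * fromℕ (suc d-1)      ≡⟨ cong (f (ι r) *_) (f-fromℕ (suc d-1)) ⟨
      f (ι r) * f (fromℕ (suc d-1))  ≡⟨ f-* (ι r) (fromℕ (suc d-1)) ⟨
      f (ι r * fromℕ (suc d-1))      ≡⟨ cong f r*denominator≡numerator ⟩
      f (ι (fromℤ n))                ≡⟨ f-fromℤ n ⟩
      ι (fromℤ n)                    ≡⟨ r*denominator≡numerator ⟨
      ι r * fromℕ (suc d-1)          ∎)
      where
      r*denominator≡numerator : ι r * fromℕ (suc d-1) ≡ ι (fromℤ n)
      r*denominator≡numerator = trans (sym (ι-* r (fromℤ (↧ r)))) (cong ι (*-↧≡↥ r))

    f-square : ∀ {x p} → x * x ≡ ι p → f x * f x ≡ x * x
    f-square {x} {p} x*x≡p = begin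
      f x * f x   ≡⟨ f-* x x ⟨
      f (x * x)   ≡⟨ cong f x*x≡p ⟩
      f (ι p)     ≡⟨ f-ι p ⟩
      ι p         ≡⟨ x*x≡p ⟨
      x * x       ∎

    f-square-root : ∀ {x p} → x * x ≡ ι p → f x ≡ x ⊎ f x ≡ - x
    f-square-root = x*x≡y*y⇒x≡y⊎x≡-y ∘ f-square

    f-+-up-to-sign : ∀ {x y p q} → x * x ≡ ι p → y * y ≡ ι q →
                     f (x + y) ≡ f x + f y ⊎ f (x + y) ≡ - (f x + f y)
    f-+-up-to-sign {x} {y} {p} {q} x*x≡p y*y≡q with x ≟ y
    ... | yes refl = inj₁ (begin
      f (x + x)          ≡⟨ cong f (solve 1 (λ x → x :+ x := # 2 :* x) refl x) ⟩
      f (fromℕ 2 * x)    ≡⟨ f-* (fromℕ 2) x ⟩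
      f (fromℕ 2) * f x  ≡⟨ cong (_* f x) f-2 ⟩
      fromℕ 2 * f x      ≡⟨ solve 1 (λ y → # 2 :* y := y :+ y) refl (f x) ⟩
      f x + f x          ∎)
    -- With u = f (x + y), v = f (x - y), w = f x + f y, w′ = f x - f y: both u v and w w′
    -- equal x² - y², and u w′ = w v, so u² w′ = w² w′.
    ... | no x≢y = x*x≡y*y⇒x≡y⊎x≡-y (*-cancelʳ (x≢y⇒x-y≢0 (injective x≢y)) (begin
      u * u * w′    ≡⟨ *-assoc u u w′ ⟩
      u * (u * w′)  ≡⟨ cong (u *_) (f-+-relation x≢y) ⟩
      u * (w * v)   ≡⟨ solve 3 (λ u v w → u :* (w :* v) := w :* (u :* v)) refl u v w ⟩
      w * (u * v)   ≡⟨ cong (w *_) (trans u*v≡x²-y² (sym w*w′≡x²-y²)) ⟩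
      w * (w * w′)  ≡⟨ *-assoc w w w′ ⟨
      w * w * w′    ∎))
      where
      u = f (x + y)
      v = f (x - y)
      w = f x + f y
      w′ = f x - f y
      x²-y²≡p-q : x * x - y * y ≡ ι (p ℚ.- q)
      x²-y²≡p-q = trans (cong₂ _-_ x*x≡p y*y≡q) (sym (ι-difference p q))
      u*v≡x²-y² : u * v ≡ x * x - y * y
      u*v≡x²-y² = begin
        u * v                     ≡⟨ f-* (x + y) (x - y) ⟨
        f ((x + y) * (x - y))     ≡⟨ cong f (solve 2 (λ x y → (x :+ y) :* (x :- y) := x :* x :- y :* y) refl x y) ⟩
        f (x * x - y * y)         ≡⟨ cong f x²-y²≡p-q ⟩
        f (ι (p ℚ.- q))           ≡⟨ f-ι (p ℚ.- q) ⟩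
        ι (p ℚ.- q)               ≡⟨ x²-y²≡p-q ⟨
        x * x - y * y             ∎
      w*w′≡x²-y² : w * w′ ≡ x * x - y * y
      w*w′≡x²-y² = begin
        w * w′                    ≡⟨ solve 2 (λ a b → (a :+ b) :* (a :- b) := a :* a :- b :* b) refl (f x) (f y) ⟩
        f x * f x - f y * f y     ≡⟨ cong₂ _-_ (f-square x*x≡p) (f-square y*y≡q) ⟩
        x * x - y * y             ∎

-- Imported only here: inside FieldOverℚ, _+_ and _*_ are the field operations.
open import Data.Rational using (ℚ; _+_; _*_; -_; _-_)

ℚ-ring : Tactic.AlmostCommutativeRing 0ℓ 0ℓ
ℚ-ring = Tactic.fromCommutativeRing ℚ.+-*-commutativeRing (λ x → dec⇒maybe (0ℚ ℚ.≟ x))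

module _ {d : ℚ} where
  open Algebra.Definitions (_≡_ {A = QS d})

  fromℚ : ℚ → QS d
  fromℚ r = r + 0ℚ √

  ⊕-assoc : Associative _⊕_
  ⊕-assoc (a + b √) (c + e √) (g + h √) = cong₂ _+_√ (ℚ.+-assoc a c g) (ℚ.+-assoc b e h)

  ⊕-comm : Commutative _⊕_
  ⊕-comm (a + b √) (c + e √) = cong₂ _+_√ (ℚ.+-comm a c) (ℚ.+-comm b e)

  ⊕-identityˡ : LeftIdentity (fromℚ 0ℚ) _⊕_
  ⊕-identityˡ (a + b √) = cong₂ _+_√ (ℚ.+-identityˡ a) (ℚ.+-identityˡ b)

  ⊕-identityʳ : RightIdentity (fromℚ 0ℚ) _⊕_
  ⊕-identityʳ (a + b √) = cong₂ _+_√ (ℚ.+-identityʳ a) (ℚ.+-identityʳ b)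

  ⊖-inverseˡ : LeftInverse (fromℚ 0ℚ) ⊖_ _⊕_
  ⊖-inverseˡ (a + b √) = cong₂ _+_√ (ℚ.+-inverseˡ a) (ℚ.+-inverseˡ b)

  ⊖-inverseʳ : RightInverse (fromℚ 0ℚ) ⊖_ _⊕_
  ⊖-inverseʳ (a + b √) = cong₂ _+_√ (ℚ.+-inverseʳ a) (ℚ.+-inverseʳ b)

  ⊗-assoc : Associative _⊗_
  ⊗-assoc (a + b √) (c + e √) (g + h √) = cong₂ _+_√ re≡ im≡
    where
    re≡ : (a * c + d * (b * e)) * g + d * ((a * e + b * c) * h) ≡ a * (c * g + d * (e * h)) + d * (b * (c * h + e * g))
    re≡ = Tactic.solve (d ∷ a ∷ b ∷ c ∷ e ∷ g ∷ h ∷ []) ℚ-ring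
    im≡ : (a * c + d * (b * e)) * h + (a * e + b * c) * g ≡ a * (c * h + e * g) + b * (c * g + d * (e * h))
    im≡ = Tactic.solve (d ∷ a ∷ b ∷ c ∷ e ∷ g ∷ h ∷ []) ℚ-ring

  ⊗-comm : Commutative _⊗_
  ⊗-comm (a + b √) (c + e √) = cong₂ _+_√ re≡ im≡
    where
    re≡ : a * c + d * (b * e) ≡ c * a + d * (e * b)
    re≡ = Tactic.solve (d ∷ a ∷ b ∷ c ∷ e ∷ []) ℚ-ring
    im≡ : a * e + b * c ≡ c * b + e * a
    im≡ = Tactic.solve (a ∷ b ∷ c ∷ e ∷ []) ℚ-ring

  ⊗-identityˡ : LeftIdentity (fromℚ 1ℚ) _⊗_
  ⊗-identityˡ (a + b √) = cong₂ _+_√ re≡ im≡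
    where
    re≡ : 1ℚ * a + d * (0ℚ * b) ≡ a
    re≡ = Tactic.solve (d ∷ a ∷ b ∷ []) ℚ-ring
    im≡ : 1ℚ * b + 0ℚ * a ≡ b
    im≡ = Tactic.solve (a ∷ b ∷ []) ℚ-ring

  ⊗-identityʳ : RightIdentity (fromℚ 1ℚ) _⊗_
  ⊗-identityʳ x = trans (⊗-comm x (fromℚ 1ℚ)) (⊗-identityˡ x)

  ⊗-distribˡ-⊕ : _⊗_ DistributesOverˡ _⊕_
  ⊗-distribˡ-⊕ (a + b √) (c + e √) (g + h √) = cong₂ _+_√ re≡ im≡
    where
    re≡ : a * (c + g) + d * (b * (e + h)) ≡ (a * c + d * (b * e)) + (a * g + d * (b * h))
    re≡ = Tactic.solve (d ∷ a ∷ b ∷ c ∷ e ∷ g ∷ h ∷ []) ℚ-ring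
    im≡ : a * (e + h) + b * (c + g) ≡ (a * e + b * c) + (a * h + b * g)
    im≡ = Tactic.solve (a ∷ b ∷ c ∷ e ∷ g ∷ h ∷ []) ℚ-ring

  ⊗-distribʳ-⊕ : _⊗_ DistributesOverʳ _⊕_
  ⊗-distribʳ-⊕ x y z = begin
    (y ⊕ z) ⊗ x        ≡⟨ ⊗-comm (y ⊕ z) x ⟩
    x ⊗ (y ⊕ z)        ≡⟨ ⊗-distribˡ-⊕ x y z ⟩
    (x ⊗ y) ⊕ (x ⊗ z)  ≡⟨ cong₂ _⊕_ (⊗-comm x y) (⊗-comm x z) ⟩
    (y ⊗ x) ⊕ (z ⊗ x)  ∎
    where open ≡-Reasoning

  ⊕-⊗-isCommutativeRing : IsCommutativeRing _≡_ _⊕_ _⊗_ ⊖_ (fromℚ 0ℚ) (fromℚ 1ℚ)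
  ⊕-⊗-isCommutativeRing = record
    { isRing = record
      { +-isAbelianGroup = record
        { isGroup = record
          { isMonoid = record
            { isSemigroup = record
              { isMagma = record { isEquivalence = isEquivalence ; ∙-cong = cong₂ _⊕_ }
              ; assoc = ⊕-assoc
              }
            ; identity = ⊕-identityˡ , ⊕-identityʳ
            }
          ; inverse = ⊖-inverseˡ , ⊖-inverseʳ
          ; ⁻¹-cong = cong ⊖_
          }
        ; comm = ⊕-comm
        }
      ; *-cong = cong₂ _⊗_
      ; *-assoc = ⊗-assoc
      ; *-identity = ⊗-identityˡ , ⊗-identityʳ
      ; distrib = ⊗-distribˡ-⊕ , ⊗-distribʳ-⊕
      }
    ; *-comm = ⊗-comm
    }

  fromℚ-+ : ∀ p q → fromℚ (p + q) ≡ fromℚ p ⊕ fromℚ q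
  fromℚ-+ p q = refl

  fromℚ-* : ∀ p q → fromℚ (p * q) ≡ fromℚ p ⊗ fromℚ q
  fromℚ-* p q = cong₂ _+_√ re≡ im≡
    where
    re≡ : p * q ≡ p * q + d * (0ℚ * 0ℚ)
    re≡ = Tactic.solve (d ∷ p ∷ q ∷ []) ℚ-ring
    im≡ : 0ℚ ≡ p * 0ℚ + 0ℚ * q
    im≡ = Tactic.solve (p ∷ q ∷ []) ℚ-ring

  _≟_ : DecidableEquality (QS d)
  (a + b √) ≟ (c + e √) =
    map′ (λ (a≡c , b≡e) → cong₂ _+_√ a≡c b≡e) (λ eq → cong re eq , cong im eq) (a ℚ.≟ c ×-dec b ℚ.≟ e)

  0≢1 : fromℚ 0ℚ ≢ fromℚ 1ℚ
  0≢1 ()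

  √d*√d≡d : √d ⊗ √d ≡ fromℚ d
  √d*√d≡d = cong₂ _+_√ re≡ im≡
    where
    re≡ : 0ℚ * 0ℚ + d * (1ℚ * 1ℚ) ≡ d
    re≡ = Tactic.solve (d ∷ []) ℚ-ring
    im≡ : 0ℚ * 1ℚ + 1ℚ * 0ℚ ≡ 0ℚ
    im≡ = refl

  √d≢⊖√d : √d {d} ≢ ⊖ √d
  √d≢⊖√d ()

  split : ∀ a b → a + b √ ≡ fromℚ a ⊕ (0ℚ + b √)
  split a b = cong₂ _+_√ (sym (ℚ.+-identityʳ a)) (sym (ℚ.+-identityˡ b))

  conj-split : ∀ a b → conj (a + b √) ≡ fromℚ a ⊕ (0ℚ + (- b) √)
  conj-split a b = cong₂ _+_√ (sym (ℚ.+-identityʳ a)) (sym (ℚ.+-identityˡ (- b)))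

  fromℚ-⊗-√d : ∀ b → fromℚ b ⊗ √d ≡ 0ℚ + b √
  fromℚ-⊗-√d b = cong₂ _+_√ re≡ im≡
    where
    re≡ : b * 0ℚ + d * (0ℚ * 1ℚ) ≡ 0ℚ
    re≡ = Tactic.solve (b ∷ d ∷ []) ℚ-ring
    im≡ : b * 1ℚ + 0ℚ * 0ℚ ≡ b
    im≡ = Tactic.solve (b ∷ []) ℚ-ring

  fromℚ-⊗-⊖√d : ∀ b → fromℚ b ⊗ (⊖ √d) ≡ 0ℚ + (- b) √
  fromℚ-⊗-⊖√d b = cong₂ _+_√ re≡ im≡
    where
    re≡ : b * (- 0ℚ) + d * (0ℚ * (- 1ℚ)) ≡ 0ℚ
    re≡ = Tactic.solve (b ∷ d ∷ []) ℚ-ring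
    im≡ : b * (- 1ℚ) + 0ℚ * (- 0ℚ) ≡ - b
    im≡ = Tactic.solve (b ∷ []) ℚ-ring

  [0+b√]²≡db² : ∀ b → (0ℚ + b √) ⊗ (0ℚ + b √) ≡ fromℚ (d * (b * b))
  [0+b√]²≡db² b = cong₂ _+_√ re≡ im≡
    where
    re≡ : 0ℚ * 0ℚ + d * (b * b) ≡ d * (b * b)
    re≡ = Tactic.solve (b ∷ d ∷ []) ℚ-ring
    im≡ : 0ℚ * b + b * 0ℚ ≡ 0ℚ
    im≡ = Tactic.solve (b ∷ []) ℚ-ring

p*p≡0⇒p≡0 : ∀ {p} → p * p ≡ 0ℚ → p ≡ 0ℚ
p*p≡0⇒p≡0 {p} p*p≡0 with p ℚ.≟ 0ℚ
... | yes p≡0 = p≡0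
... | no  p≢0 = begin
  p                      ≡⟨ ℚ.*-identityʳ p ⟨
  p * 1ℚ               ≡⟨ cong (p *_) (ℚ.*-inverseʳ p) ⟨
  p * (p * ℚ.1/ p)   ≡⟨ ℚ.*-assoc p p (ℚ.1/ p) ⟨
  p * p * ℚ.1/ p     ≡⟨ cong (_* ℚ.1/ p) p*p≡0 ⟩
  0ℚ * ℚ.1/ p          ≡⟨ ℚ.*-zeroˡ (ℚ.1/ p) ⟩
  0ℚ                     ∎
  where
  open ≡-Reasoning
  instance _ = ℚ.≢-nonZero p≢0

module _ {d : ℚ} (d-nonsquare : ∀ (q : ℚ) → q * q ≢ d) where
  open ≡-Reasoning

  p*inv[p]≡1 : ∀ {p} → p ≢ 0ℚ → p * inv {d} p ≡ 1ℚ
  p*inv[p]≡1 {p} p≢0 with p ℚ.≟ 0ℚ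
  ... | yes p≡0 = ⊥-elim (p≢0 p≡0)
  ... | no  p≢0′ = ℚ.*-inverseʳ p {{ℚ.≢-nonZero p≢0′}}

  norm≢0 : ∀ a b → (a + b √) ≢ fromℚ {d} 0ℚ → a * a - d * (b * b) ≢ 0ℚ
  norm≢0 a b x≢0 norm≡0 with b ℚ.≟ 0ℚ
  ... | yes refl = x≢0 (cong₂ _+_√ (p*p≡0⇒p≡0 (trans (identity a d) norm≡0)) refl)
    where
    identity : ∀ a d → a * a ≡ a * a - d * (0ℚ * 0ℚ)
    identity = Tactic.solve-∀ ℚ-ring
  ... | no  b≢0 = d-nonsquare (a * b⁻¹) (begin
    a * b⁻¹ * (a * b⁻¹)                        ≡⟨ identity a b d b⁻¹ ⟩
    (a * a - d * (b * b)) * (b⁻¹ * b⁻¹)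
      + d * (b * b⁻¹ * (b * b⁻¹))              ≡⟨ cong₂ (λ u v → u * (b⁻¹ * b⁻¹) + d * (v * v))
                                                        norm≡0 (ℚ.*-inverseʳ b) ⟩
    0ℚ * (b⁻¹ * b⁻¹) + d * (1ℚ * 1ℚ)           ≡⟨ simplify d b⁻¹ ⟩
    d                                          ∎)
    where
    instance _ = ℚ.≢-nonZero b≢0
    b⁻¹ = ℚ.1/ b
    identity : ∀ a b d i → a * i * (a * i) ≡ (a * a - d * (b * b)) * (i * i) + d * (b * i * (b * i))
    identity = Tactic.solve-∀ ℚ-ring
    simplify : ∀ d i → 0ℚ * (i * i) + d * (1ℚ * 1ℚ) ≡ d
    simplify = Tactic.solve-∀ ℚ-ring

  ⊗-recip : ∀ {x : QS d} → x ≢ fromℚ 0ℚ → x ⊗ recip x ≡ fromℚ 1ℚ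
  ⊗-recip {a + b √} x≢0 = cong₂ _+_√
    (trans (re≡ a b d n) (p*inv[p]≡1 (norm≢0 a b x≢0))) (im≡ a b n)
    where
    n = inv {d} (a * a - d * (b * b))
    re≡ : ∀ a b d n → a * (a * n) + d * (b * (- (b * n))) ≡ (a * a - d * (b * b)) * n
    re≡ = Tactic.solve-∀ ℚ-ring
    im≡ : ∀ a b n → a * (- (b * n)) + b * (a * n) ≡ 0ℚ
    im≡ = Tactic.solve-∀ ℚ-ring

module QS-SDMap
  {d : ℚ} (d-nonsquare : ∀ (q : ℚ) → q * q ≢ d) {f : QS d → QS d} (isSD : IsSD d f) where
  open FieldOverℚ fromℚ ⊕-⊗-isCommutativeRing fromℚ-+ fromℚ-* _≟_ recip (⊗-recip d-nonsquare) 0≢1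
    using (module SDMap)
  open SDMap isSD using (f-ι; f-*; f-square-root; f-+-up-to-sign)
  open ≡-Reasoning

  f-b√ : ∀ b → f (0ℚ + b √) ≡ fromℚ b ⊗ f √d
  f-b√ b = begin
    f (0ℚ + b √)           ≡⟨ cong f (fromℚ-⊗-√d b) ⟨
    f (fromℚ b ⊗ √d)       ≡⟨ f-* (fromℚ b) √d ⟩
    f (fromℚ b) ⊗ f √d     ≡⟨ cong (_⊗ f √d) (f-ι b) ⟩
    fromℚ b ⊗ f √d         ∎

  f-up-to-sign : ∀ {g : QS d → QS d} → (∀ a b → fromℚ a ⊕ (fromℚ b ⊗ f √d) ≡ g (a + b √)) →
                 ∀ z → f z ≡ g z ⊎ f z ≡ ⊖ g z
  f-up-to-sign {g} g-linear (a + b √) =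
    Sum.map (λ eq → trans f[a+b√]≡ (trans eq sum≡)) (λ eq → trans f[a+b√]≡ (trans eq (cong ⊖_ sum≡)))
      (f-+-up-to-sign (sym (fromℚ-* a a)) ([0+b√]²≡db² b))
    where
    f[a+b√]≡ : f (a + b √) ≡ f (fromℚ a ⊕ (0ℚ + b √))
    f[a+b√]≡ = cong f (split a b)
    sum≡ : f (fromℚ a) ⊕ f (0ℚ + b √) ≡ g (a + b √)
    sum≡ = trans (cong₂ _⊕_ (f-ι a) (f-b√ b)) (g-linear a b)

  classification : Case1 d f ⊎ Case2 d f
  classification = Sum.map case1 case2 (f-square-root √d*√d≡d)
    where
    case1 : f √d ≡ √d → Case1 d f
    case1 f√d≡√d = f√d≡√d , f-up-to-sign λ a b → begin
      fromℚ a ⊕ (fromℚ b ⊗ f √d)  ≡⟨ cong (λ s → fromℚ a ⊕ (fromℚ b ⊗ s)) f√d≡√d ⟩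
      fromℚ a ⊕ (fromℚ b ⊗ √d)    ≡⟨ cong (fromℚ a ⊕_) (fromℚ-⊗-√d b) ⟩
      fromℚ a ⊕ (0ℚ + b √)        ≡⟨ split a b ⟨
      a + b √                     ∎
    case2 : f √d ≡ ⊖ √d → Case2 d f
    case2 f√d≡-√d = f√d≡-√d , f-up-to-sign λ a b → begin
      fromℚ a ⊕ (fromℚ b ⊗ f √d)       ≡⟨ cong (λ s → fromℚ a ⊕ (fromℚ b ⊗ s)) f√d≡-√d ⟩
      fromℚ a ⊕ (fromℚ b ⊗ (⊖ √d))     ≡⟨ cong (fromℚ a ⊕_) (fromℚ-⊗-⊖√d b) ⟩
      fromℚ a ⊕ (0ℚ + (- b) √)       ≡⟨ conj-split a b ⟨
      conj (a + b √)                   ∎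

¬Case1×Case2 : ∀ {d f} → ¬ (Case1 d f × Case2 d f)
¬Case1×Case2 ((f√d≡√d , _) , (f√d≡-√d , _)) = √d≢⊖√d (trans (sym f√d≡√d) f√d≡-√d)

proposition5p2 : (d : ℚ) → (∀ (q : ℚ) → q * q ≢ d) →
    (f : QS d → QS d) → IsSD d f →
    (Case1 d f ⊎ Case2 d f) × ¬ (Case1 d f × Case2 d f)
proposition5p2 d d-nonsquare f isSD = QS-SDMap.classification d-nonsquare isSD , ¬Case1×Case2
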